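{- Every graph $G$ with $tb(G)\le 1$ has cop-number at most $2$, and this upper bound is sharp (there exists a graph with tree-breadth at most one and cop-number exactly $2$).
   Context: Graphs are finite, simple, connected and unweighted. $tb(G)$ is the tree-breadth: the minimum, over tree decompositions $(T,(X_t))$ of $G$ (trees whose bags are vertex subsets covering all vertices and edges, the bags containing any vertex inducing a subtree), of $\max_t\min_{v\in V(G)}\max_{w\in X_t}dist_G(v,w)$. The cop-number is that of the classical Cops and Robber game. -}

module Defs where

open import Data.Nat using (ℕ; zero; suc; _≤_; _<_)
open import Data.Fin using (Fin)
open import Data.Fin.Subset using (Subset; _∈_)
open import Data.Bool using (Bool; true; false; T)
open import Data.List using (List; []; _∷_; _++_; [_]; length)
open import Data.List.Relation.Unary.Linked using (Linked)
open import Data.List.Relation.Unary.Unique.Propositional using (Unique)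
open import Data.Product using (Σ; ∃; ∃-syntax; _×_; _,_)
open import Data.Sum using (_⊎_)
open import Relation.Nullary using (¬_)
open import Relation.Binary.PropositionalEquality using (_≡_)
open import Relation.Binary.Construct.Closure.ReflexiveTransitive using (Star)

record Graph : Set where
  field
    n        : ℕ
    E        : Fin n → Fin n → Bool
    sym      : ∀ u v → E u v ≡ E v u
    irrefl   : ∀ v → E v v ≡ false
    nonempty : 0 < n

  _~_ : Fin n → Fin n → Set
  u ~ v = T (E u v)

  field
    connected : ∀ u v → Star _~_ u v

open Graph public

data Walk (G : Graph) : Fin (n G) → Fin (n G) → ℕ → Set where
  here : ∀ {u} → Walk G u u 0
  step : ∀ {u v w k} → _~_ G u v → Walk G v w k → Walk G u w (suc k)

DistLe : (G : Graph) → Fin (n G) → Fin (n G) → ℕ → Set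
DistLe G u w r = ∃[ k ] (k ≤ r × Walk G u w k)

-- a cycle: distinct vertices v ∷ vs (at least 3), consecutive ones
-- adjacent, and the last adjacent to the first
HasCycle : Graph → Set
HasCycle G = Σ (Fin (n G)) λ v → Σ (List (Fin (n G))) λ vs →
  (2 ≤ length vs) × Unique (v ∷ vs) × Linked (_~_ G) (v ∷ vs ++ [ v ])

record Tree : Set where
  field
    graph   : Graph
    acyclic : ¬ HasCycle graph

record TreeDecomposition (G : Graph) : Set where
  field
    tree : Tree
  T′ : Graph
  T′ = Tree.graph tree
  field
    bag      : Fin (n T′) → Subset (n G)
    covV     : ∀ v → ∃[ t ] (v ∈ bag t)
    covE     : ∀ u v → _~_ G u v → ∃[ t ] (u ∈ bag t × v ∈ bag t)
    -- the bags containing v induce a connected subtree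
    subtree  : ∀ v t t′ → v ∈ bag t → v ∈ bag t′ →
               Star (λ a b → _~_ T′ a b × v ∈ bag a × v ∈ bag b) t t′

BreadthLe : (G : Graph) → TreeDecomposition G → ℕ → Set
BreadthLe G D r = ∀ t → ∃[ v ] (∀ w → w ∈ TreeDecomposition.bag D t → DistLe G v w r)

TreeBreadthLe : Graph → ℕ → Set
TreeBreadthLe G r = Σ (TreeDecomposition G) λ D → BreadthLe G D r

module _ (G : Graph) (k : ℕ) where
  Move : Fin (n G) → Fin (n G) → Set
  Move u u′ = u ≡ u′ ⊎ _~_ G u u′

  Captured : (Fin k → Fin (n G)) → Fin (n G) → Set
  Captured C r = ∃[ i ] (C i ≡ r)

  -- cops (at C, to move) can force capture of the robber at r
  data CopsForce (C : Fin k → Fin (n G)) (r : Fin (n G)) : Set where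
    caught : Captured C r → CopsForce C r
    play   : (C′ : Fin k → Fin (n G)) → (∀ i → Move (C i) (C′ i)) →
             (Captured C′ r ⊎ (∀ r′ → Move r r′ → CopsForce C′ r′)) →
             CopsForce C r

  -- k cops have a winning strategy: they place first, then the robber
  -- places, then cops and robber alternate, cops moving first
  CopsWin : Set
  CopsWin = Σ (Fin k → Fin (n G)) λ C₀ → ∀ r₀ → CopsForce C₀ r₀

IsCopNumber : Graph → ℕ → Set
IsCopNumber G c = CopsWin G c × (∀ k → k < c → ¬ CopsWin G k)

-- Zero cops never win, and whether one cop wins is decidable: the positions from which a cop forces capture
-- within m rounds form an increasing, hence eventually stationary, chain of relations on a finite set, and the
-- stationary value is the whole winning region.  So it suffices that two cops win when tb(G) ≤ 1.  Then a cop on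
-- the centre of a bag t dominates that bag, which separates G, so the robber is confined to one branch of the
-- decomposition tree at t; the other cop walks to the centre of the neighbouring bag t′ on that branch and the
-- roles swap.  The guarded bags follow a non-backtracking walk in a tree, i.e. a path, so the robber is caught.
-- The 4-cycle is sharp: two bags of radius one, dominated by two antipodal cops, while a robber staying
-- antipodal to a single cop is never caught.
module Submission where

open import Defs hiding (sym)
open import Data.Bool using (T)
open import Data.Empty using (⊥; ⊥-elim)
open import Data.Fin using (Fin; zero; suc; toℕ; fromℕ<; combine; remQuot; opposite; _≟_)
open import Data.Fin.Properties using (any?; all?; pigeonhole; remQuot-combine; opposite-involutive)
open import Data.List using (List; []; _∷_; _++_; [_]; length; lookup)
open import Data.List.Membership.Propositional.Properties using (∈-lookup)
open import Data.List.Relation.Unary.All as All using (All; []; _∷_)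
open import Data.List.Relation.Unary.All.Properties using (¬Any⇒All¬)
open import Data.List.Relation.Unary.AllPairs using ([]; _∷_)
open import Data.List.Relation.Unary.Any using (here; there)
open import Data.List.Relation.Unary.Linked using (Linked; []; [-]; _∷_)
open import Data.List.Relation.Unary.Unique.Propositional using (Unique)
open import Data.Nat using (ℕ; zero; suc; _+_; _≤_; _<_; _≤′_; ≤′-refl; ≤′-step; z≤n; s≤s)
open import Data.Nat.Properties using (≤-refl; ≤-trans; ≰⇒>; <⇒≱; _≤?_; ≤⇒≤′; n<1+n; n≤1+n; m≤m+n; +-suc)
open import Data.Product using (∃-syntax; _×_; _,_; proj₁; proj₂; uncurry)
open import Data.Sum using (_⊎_; inj₁; inj₂; [_,_]′)
open import Data.Unit using (tt)
open import Function using (_∘_; id)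
open import Relation.Binary.Construct.Closure.ReflexiveTransitive using (Star; ε; _◅_; _◅◅_; gmap; reverse)
open import Relation.Binary.PropositionalEquality using (_≡_; _≢_; refl; sym; trans; subst; ≢-sym)
open import Relation.Nullary using (¬_; Dec; yes; no; ¬?)
open import Relation.Nullary.Decidable using (_×-dec_; _⊎-dec_; _→-dec_; decidable-stable)
open import Relation.Nullary.Decidable.Core using (T?)

unique-lookup-injective : {A : Set} {xs : List A} → Unique xs →
                          ∀ {i j} → toℕ i < toℕ j → lookup xs i ≢ lookup xs j
unique-lookup-injective (x∉xs ∷ _) {zero} {suc j} _ = All.lookup x∉xs (∈-lookup j)
unique-lookup-injective (_ ∷ xs!) {suc i} {suc j} (s≤s i<j) = unique-lookup-injective xs! i<j

unique⇒length≤ : ∀ {k} {xs : List (Fin k)} → Unique xs → length xs ≤ k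
unique⇒length≤ {k} {xs} xs! with length xs ≤? k
... | yes ≤k = ≤k
... | no ≰k with pigeonhole (≰⇒> ≰k) (lookup xs)
...   | i , j , i<j , same = ⊥-elim (unique-lookup-injective xs! i<j same)

module _ {k : ℕ} (P : ℕ → Fin k → Set) (P? : ∀ m x → Dec (P m x))
         (P-grows : ∀ m x → P m x → P (suc m) x) where

  private
    Newcomer : ℕ → Set
    Newcomer j = ∃[ x ] (P (suc j) x × ¬ P j x)

    newcomer? : ∀ j → Dec (Newcomer j)
    newcomer? j = any? λ x → P? (suc j) x ×-dec ¬? (P? j x)

    P-grows* : ∀ {m m′} x → m ≤′ m′ → P m x → P m′ x
    P-grows* x ≤′-refl       p = p
    P-grows* x (≤′-step m≤m′) p = P-grows _ x (P-grows* x m≤m′ p)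

    newcomers-distinct : ∀ {i j : Fin (suc k)} → toℕ i < toℕ j → (new-i : Newcomer (toℕ i)) (new-j : Newcomer (toℕ j)) →
                         proj₁ new-i ≢ proj₁ new-j
    newcomers-distinct i<j (x , Px , _) (.x , _ , ¬Px) refl = ¬Px (P-grows* x (≤⇒≤′ i<j) Px)

    entrant : ¬ (∃[ j ] ¬ Newcomer (toℕ {suc k} j)) → ∀ j → Newcomer (toℕ j)
    entrant always j = decidable-stable (newcomer? (toℕ j)) (λ none → always (j , none))

  -- If a point entered at each step 0, …, k, these k + 1 entrants would be distinct points of Fin k.
  chain-stabilises : ∃[ j ] (∀ x → P (suc j) x → P j x)
  chain-stabilises with any? (λ (j : Fin (suc k)) → ¬? (newcomer? (toℕ j)))
  ... | yes (j , none) = toℕ j , λ x new → decidable-stable (P? (toℕ j) x) (λ old → none (x , new , old))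
  ... | no always with pigeonhole (n<1+n k) (proj₁ ∘ entrant always)
  ...   | i , j , i<j , same = ⊥-elim (newcomers-distinct i<j (entrant always i) (entrant always j) same)

relation-chain-stabilises : ∀ {a b} (R : ℕ → Fin a → Fin b → Set) → (∀ m x y → Dec (R m x y)) →
                            (∀ m x y → R m x y → R (suc m) x y) →
                            ∃[ j ] (∀ x y → R (suc j) x y → R j x y)
relation-chain-stabilises {b = b} R R? R-grows =
  let j , stable = chain-stabilises P P? (λ m _ → R-grows m _ _) in
  j , λ x y → subst (uncurry (R j)) (remQuot-combine x y)
            ∘ stable (combine x y)
            ∘ subst (uncurry (R (suc j))) (sym (remQuot-combine x y))
  where
  P : ℕ → Fin _ → Set
  P m = uncurry (R m) ∘ remQuot b
  P? : ∀ m p → Dec (P m p)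
  P? m p = uncurry (R? m) (remQuot b p)

module _ (G : Graph) where

  private
    V = Fin (n G)

  Near : V → V → Set
  Near u v = u ≡ v ⊎ _~_ G u v

  near? : ∀ u v → Dec (Near u v)
  near? u v = (u ≟ v) ⊎-dec T? (E G u v)

  distLe1⇒near : ∀ {u v} → DistLe G u v 1 → Near u v
  distLe1⇒near (zero , _ , here)                = inj₁ refl
  distLe1⇒near (suc zero , _ , step u~v here)   = inj₂ u~v
  distLe1⇒near (suc (suc _) , s≤s () , _)

  near⇒distLe1 : ∀ {u v} → Near u v → DistLe G u v 1
  near⇒distLe1 (inj₁ refl) = 0 , z≤n , here
  near⇒distLe1 (inj₂ u~v)  = 1 , ≤-refl , step u~v here

  zero-cops-lose : ¬ CopsWin G 0
  zero-cops-lose (_ , wins) = lose (wins (fromℕ< (nonempty G)))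
    where
    lose : ∀ {C r} → CopsForce G 0 C r → ⊥
    lose (caught (() , _))
    lose (play _ _ (inj₁ (() , _)))
    lose (play _ _ (inj₂ next)) = lose (next _ (inj₁ refl))

  module _ {k k′} (σ : Fin k′ → Fin k) (onto : ∀ i → ∃[ j ] σ j ≡ i) where

    private
      relabel-capture : ∀ {C r} → Captured G k C r → Captured G k′ (C ∘ σ) r
      relabel-capture (i , Ci≡r) with onto i
      ... | j , refl = j , Ci≡r

    force-relabel : ∀ {C D r} → (∀ j → D j ≡ C (σ j)) → CopsForce G k C r → CopsForce G k′ D r
    force-relabel D≗C∘σ (caught (i , Ci≡r)) with onto i
    ... | j , refl = caught (j , trans (D≗C∘σ j) Ci≡r)
    force-relabel {D = D} D≗C∘σ (play C′ moves next) = play (C′ ∘ σ) relabel-moves (relabel-next next)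
      where
      relabel-moves : ∀ j → Move G k′ (D j) (C′ (σ j))
      relabel-moves j = subst (λ c → Move G k′ c _) (sym (D≗C∘σ j)) (moves (σ j))

      relabel-next : ∀ {r} → Captured G k C′ r ⊎ (∀ r′ → Move G k r r′ → CopsForce G k C′ r′) →
                     Captured G k′ (C′ ∘ σ) r ⊎ (∀ r′ → Move G k′ r r′ → CopsForce G k′ (C′ ∘ σ) r′)
      relabel-next (inj₁ capture) = inj₁ (relabel-capture capture)
      relabel-next (inj₂ next′)   = inj₂ λ r′ r→r′ → force-relabel (λ _ → refl) (next′ r′ r→r′)

  -- Catch m c r: a cop at c, to move, can catch a robber at r within m rounds.
  Catch : ℕ → V → V → Set
  Catch zero    c r = c ≡ r
  Catch (suc m) c r = c ≡ r ⊎ ∃[ c′ ] (Near c c′ × (c′ ≡ r ⊎ (∀ r′ → Near r r′ → Catch m c′ r′)))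

  catch? : ∀ m c r → Dec (Catch m c r)
  catch? zero    c r = c ≟ r
  catch? (suc m) c r = (c ≟ r) ⊎-dec any? λ c′ → near? c c′ ×-dec
                         ((c′ ≟ r) ⊎-dec all? λ r′ → near? r r′ →-dec catch? m c′ r′)

  catch-grows : ∀ m {c r} → Catch m c r → Catch (suc m) c r
  catch-grows zero    c≡r                            = inj₁ c≡r
  catch-grows (suc m) (inj₁ c≡r)                     = inj₁ c≡r
  catch-grows (suc m) (inj₂ (c′ , c→c′ , inj₁ c′≡r)) = inj₂ (c′ , c→c′ , inj₁ c′≡r)
  catch-grows (suc m) (inj₂ (c′ , c→c′ , inj₂ next)) =
    inj₂ (c′ , c→c′ , inj₂ λ r′ r→r′ → catch-grows m (next r′ r→r′))

  catch-sound : ∀ m {C r} → Catch m (C zero) r → CopsForce G 1 C r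
  catch-sound zero    c≡r                            = caught (zero , c≡r)
  catch-sound (suc m) (inj₁ c≡r)                     = caught (zero , c≡r)
  catch-sound (suc m) (inj₂ (c′ , c→c′ , inj₁ c′≡r)) = play (λ _ → c′) (λ { zero → c→c′ }) (inj₁ (zero , c′≡r))
  catch-sound (suc m) (inj₂ (c′ , c→c′ , inj₂ next)) =
    play (λ _ → c′) (λ { zero → c→c′ }) (inj₂ λ r′ r→r′ → catch-sound m (next r′ r→r′))

  catch-complete : ∀ {j} → (∀ c r → Catch (suc j) c r → Catch j c r) →
                   ∀ {C r} → CopsForce G 1 C r → Catch j (C zero) r
  catch-complete stable (caught (zero , c≡r)) = stable _ _ (inj₁ c≡r)
  catch-complete {j} stable (play C′ moves next) =
    stable _ _ (inj₂ (C′ zero , moves zero , continue next))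
    where
    continue : ∀ {r} → Captured G 1 C′ r ⊎ (∀ r′ → Move G 1 r r′ → CopsForce G 1 C′ r′) →
               C′ zero ≡ r ⊎ (∀ r′ → Near r r′ → Catch j (C′ zero) r′)
    continue (inj₁ (zero , c′≡r)) = inj₁ c′≡r
    continue (inj₂ next′)         = inj₂ λ r′ r→r′ → catch-complete stable (next′ r′ r→r′)

  one-cop-wins? : Dec (CopsWin G 1)
  one-cop-wins? with relation-chain-stabilises Catch catch? (λ m _ _ → catch-grows m)
  ... | j , stable with any? (λ c → all? (λ r → catch? j c r))
  ...   | yes (c , wins) = yes ((λ _ → c) , λ r → catch-sound j (wins r))
  ...   | no loses       = no λ (C , wins) → loses (C zero , λ r → catch-complete stable (wins r))

  copNumber≤2 : CopsWin G 2 → ∃[ c ] (IsCopNumber G c × c ≤ 2)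
  copNumber≤2 two with one-cop-wins?
  ... | yes one = 1 , (one , λ { zero _ → zero-cops-lose ; (suc _) (s≤s ()) }) , s≤s z≤n
  ... | no ¬one = 2 , (two , λ { zero _ → zero-cops-lose ; (suc zero) _ → ¬one ; (suc (suc _)) (s≤s (s≤s ())) }) , ≤-refl

  -- A robber standing at σ c, out of reach of the cop at c, can always restore this.
  one-cop-evaded : (σ : V → V) → (∀ {u v} → Near u v → Near (σ u) (σ v)) → (∀ v → ¬ Near v (σ v)) →
                   ¬ CopsWin G 1
  one-cop-evaded σ σ-near σ-far (C , wins) = evade (wins (σ (C zero))) refl
    where
    evade : ∀ {C r} → CopsForce G 1 C r → r ≡ σ (C zero) → ⊥
    evade {C} (caught (zero , c≡r)) refl = σ-far (C zero) (inj₁ c≡r)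
    evade {C} (play C′ moves (inj₁ (zero , c′≡r))) refl = σ-far (C zero) (subst (Near (C zero)) c′≡r (moves zero))
    evade (play C′ moves (inj₂ next)) refl = evade (next (σ (C′ zero)) (σ-near (moves zero))) refl

module _ (H : Graph) where

  open import Data.List.Membership.Propositional using (_∈_)

  private
    V = Fin (n H)
    _~ᴴ_ = _~_ H

  ~-sym : ∀ {u v} → u ~ᴴ v → v ~ᴴ u
  ~-sym {u} {v} = subst T (Graph.sym H u v)

  ~-irrefl : ∀ {v} → ¬ v ~ᴴ v
  ~-irrefl {v} = subst T (irrefl H v)

  ~⇒≢ : ∀ {u v} → u ~ᴴ v → u ≢ v
  ~⇒≢ u~v refl = ~-irrefl u~v

  cycle⇒3≤n : HasCycle H → 3 ≤ n H
  cycle⇒3≤n (_ , _ , 2≤length , cycle! , _) = ≤-trans (s≤s 2≤length) (unique⇒length≤ cycle!)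

  private
    segment : ∀ {y w zs} → Unique (y ∷ zs) → Linked _~ᴴ_ (y ∷ zs) → w ∈ zs →
              ∃[ ys ] (All (_∈ zs) ys × Unique (w ∷ y ∷ ys) × Linked _~ᴴ_ (y ∷ ys ++ [ w ]))
    segment ((y≢z ∷ _) ∷ _) (y~z ∷ _) (here refl) = [] , [] , (≢-sym y≢z ∷ []) ∷ [] ∷ [] , y~z ∷ [-]
    segment (y∉ ∷ zs!) (y~z ∷ zs-linked) (there w∈zs) with segment zs! zs-linked w∈zs
    ... | ys , ys⊆zs , (w≢z ∷ w∉ys) ∷ zys! , link =
      _ ∷ ys , here refl ∷ All.map there ys⊆zs ,
      (≢-sym (All.lookup y∉ (there w∈zs)) ∷ w≢z ∷ w∉ys) ∷
        (All.head y∉ ∷ All.map (All.lookup (All.tail y∉)) ys⊆zs) ∷ zys! ,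
      y~z ∷ link

  -- A path in H listed from its newest vertex x, whose predecessor is y.
  record Trail (y x : V) : Set where
    field
      visited : List V
      unique  : Unique (x ∷ y ∷ visited)
      linked  : Linked _~ᴴ_ (x ∷ y ∷ visited)

  edge-trail : ∀ {y x} → y ~ᴴ x → Trail y x
  edge-trail y~x = record { visited = [] ; unique = (≢-sym (~⇒≢ y~x) ∷ []) ∷ [] ∷ [] ; linked = ~-sym y~x ∷ [-] }

  trail-short : ∀ {y x} (tr : Trail y x) → length (Trail.visited tr) < n H
  trail-short tr = ≤-trans (n≤1+n _) (unique⇒length≤ (Trail.unique tr))

  -- Without backtracking, a walk in an acyclic graph never revisits a vertex: otherwise it closes a cycle.
  extend-trail : ¬ HasCycle H → ∀ {y x w} → Trail y x → x ~ᴴ w → w ≢ y → Trail x w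
  extend-trail acyclic {y} {x} {w} tr x~w w≢y = record
    { visited = y ∷ visited
    ; unique  = ¬Any⇒All¬ _ w∉ ∷ unique
    ; linked  = ~-sym x~w ∷ linked
    }
    where
    open Trail tr
    w∉ : ¬ (w ∈ x ∷ y ∷ visited)
    w∉ (here refl)              = ~-irrefl x~w
    w∉ (there (here w≡y))       = w≢y w≡y
    w∉ (there (there w∈visited)) with unique | linked
    ... | x∉ ∷ y∷visited! | x~y ∷ y∷visited-linked with segment y∷visited! y∷visited-linked w∈visited
    ...   | ys , ys⊆ , (_ ∷ w∉ys) ∷ ys! , link = acyclic
      (w , x ∷ y ∷ ys , s≤s (s≤s z≤n) ,
       (≢-sym (~⇒≢ x~w) ∷ w≢y ∷ w∉ys) ∷
         (All.head x∉ ∷ All.map (All.lookup (All.tail x∉)) ys⊆) ∷ ys! ,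
       ~-sym x~w ∷ x~y ∷ link)

  EdgeWithin : (V → Set) → V → V → Set
  EdgeWithin Q u v = u ~ᴴ v × Q u × Q v

  Branch : V → V → V → Set
  Branch x = Star (EdgeWithin (_≢ x))

  private
    last-visit : ∀ {Q x y s} → Star (EdgeWithin Q) y s → s ≢ x →
                 (y ≢ x × Branch x y s) ⊎ ∃[ z ] (x ~ᴴ z × Q z × Branch x z s)
    last-visit ε s≢x = inj₁ (s≢x , ε)
    last-visit {x = x} {y} (_◅_ {j = y′} (y~y′ , Qy , Qy′) walk) s≢x with last-visit walk s≢x
    ... | inj₂ exit = inj₂ exit
    ... | inj₁ (y′≢x , branch) with y ≟ x
    ...   | yes refl = inj₂ (y′ , y~y′ , Qy′ , branch)
    ...   | no y≢x   = inj₁ (y≢x , (y~y′ , y≢x , y′≢x) ◅ branch)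

  departure : ∀ {Q x s} → Star (EdgeWithin Q) x s → s ≢ x → ∃[ z ] (x ~ᴴ z × Q z × Branch x z s)
  departure walk s≢x with last-visit walk s≢x
  ... | inj₁ (x≢x , _) = ⊥-elim (x≢x refl)
  ... | inj₂ exit      = exit

module _ (G : Graph) where

  private
    V = Fin (n G)

  cops : V → V → Fin 2 → V
  cops g c zero    = g
  cops g c (suc _) = c

  cops-move : ∀ {g g′ c c′} → Near G g g′ → Near G c c′ → ∀ i → Move G 2 (cops g c i) (cops g′ c′ i)
  cops-move g→g′ c→c′ zero    = g→g′
  cops-move g→g′ c→c′ (suc _) = c→c′

  first-cop-captures : ∀ {g c r} → Near G g r → CopsForce G 2 (cops g c) r
  first-cop-captures g→r = play _ (cops-move g→r (inj₁ refl)) (inj₁ (zero , refl))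

  second-cop-captures : ∀ {g c r} → Near G c r → CopsForce G 2 (cops g c) r
  second-cop-captures c→r = play _ (cops-move (inj₁ refl) c→r) (inj₁ (suc zero , refl))

  swap-cops : ∀ {g c r} → CopsForce G 2 (cops c g) r → CopsForce G 2 (cops g c) r
  swap-cops = force-relabel G opposite (λ i → opposite i , opposite-involutive i) λ { zero → refl ; (suc zero) → refl }

  dominating-pair-wins : ∀ g c → (∀ r → Near G g r ⊎ Near G c r) → CopsWin G 2
  dominating-pair-wins g c dominates = cops g c , [ first-cop-captures , second-cop-captures ]′ ∘ dominates

module _ (G : Graph) (D : TreeDecomposition G) (narrow : BreadthLe G D 1) where

  open TreeDecomposition D
  open import Data.Fin.Subset using (_∈_)

  private
    V    = Fin (n G)
    Node = Fin (n T′)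

  centre : Node → V
  centre t = proj₁ (narrow t)

  centre-near : ∀ t {w} → w ∈ bag t → Near G (centre t) w
  centre-near t w∈t = distLe1⇒near G (proj₂ (narrow t) _ w∈t)

  InBranch : Node → Node → V → Set
  InBranch t t′ r = ∃[ s ] (r ∈ bag s × Branch T′ t t′ s)

  robber-confined : ∀ {t t′ r r′} → ¬ Near G (centre t) r → InBranch t t′ r → Near G r r′ → InBranch t t′ r′
  robber-confined far inside (inj₁ refl) = inside
  robber-confined {t} {r = r} far (s , r∈s , branch) (inj₂ r~r′) with covE _ _ r~r′
  ... | u , r∈u , r′∈u = u , r′∈u , branch ◅◅ gmap id avoid (subtree r s u r∈s r∈u)
    where
    r∉t : ∀ {a} → r ∈ bag a → a ≢ t
    r∉t r∈a refl = far (centre-near t r∈a)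
    avoid : ∀ {a b} → _~_ T′ a b × r ∈ bag a × r ∈ bag b → EdgeWithin T′ (_≢ t) a b
    avoid (a~b , r∈a , r∈b) = a~b , r∉t r∈a , r∉t r∈b

  private
    Fuel : ℕ → ∀ {t t′} → Trail T′ t t′ → Set
    Fuel m tr = n T′ ≤ m + length (Trail.visited tr)

  -- The guard is on centre t, the chaser on p, heading for centre t′; the cops are to move.
  mutual
    chase : ∀ m {t t′} (tr : Trail T′ t t′) → Fuel m tr → ∀ {p r} → Star (_~_ G) p (centre t′) →
            InBranch t t′ r → CopsForce G 2 (cops G (centre t) p) r
    chase m {t} tr fuel {r = r} walk inside with near? G (centre t) r
    ... | yes guard→r = first-cop-captures G guard→r
    ... | no far      = advance m tr fuel walk far inside

    advance : ∀ m {t t′} (tr : Trail T′ t t′) → Fuel m tr → ∀ {p r} → Star (_~_ G) p (centre t′) →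
              ¬ Near G (centre t) r → InBranch t t′ r → CopsForce G 2 (cops G (centre t) p) r
    advance m tr fuel (p~q ◅ walk) far inside =
      play _ (cops-move G (inj₁ refl) (inj₂ p~q))
           (inj₂ λ r′ r→r′ → chase m tr fuel walk (robber-confined far inside r→r′))
    advance m {t′ = t′} tr fuel {r = r} ε far (s , r∈s , branch) with near? G (centre t′) r
    ... | yes chaser→r = second-cop-captures G chaser→r
    ... | no far′      = hand-over m tr fuel (departure T′ branch s≢t′) r∈s
      where
      s≢t′ : s ≢ t′
      s≢t′ refl = far′ (centre-near s r∈s)

    hand-over : ∀ m {t t′ s r} (tr : Trail T′ t t′) → Fuel m tr →
                ∃[ t″ ] (_~_ T′ t′ t″ × t″ ≢ t × Branch T′ t′ t″ s) → r ∈ bag s →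
                CopsForce G 2 (cops G (centre t) (centre t′)) r
    hand-over zero    tr fuel _ _ = ⊥-elim (<⇒≱ (trail-short T′ tr) fuel)
    hand-over (suc m) tr fuel (t″ , t′~t″ , t″≢t , branch) r∈s =
      swap-cops G (chase m (extend-trail T′ (Tree.acyclic tree) tr t′~t″ t″≢t)
                         (subst (n T′ ≤_) (sym (+-suc m _)) fuel)
                         (connected G _ _) (_ , r∈s , branch))

  two-cops-win : CopsWin G 2
  two-cops-win = cops G (centre t₀) (centre t₀) , start
    where
    t₀ : Node
    t₀ = fromℕ< (nonempty T′)

    start : ∀ r → CopsForce G 2 (cops G (centre t₀) (centre t₀)) r
    start r with near? G (centre t₀) r
    ... | yes guard→r = first-cop-captures G guard→r
    ... | no far with covV r
    ...   | s , r∈s with departure T′ (gmap id (λ t~u → t~u , tt , tt) (connected T′ t₀ s))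
                                        (λ s≡t₀ → far (centre-near t₀ (subst (λ u → r ∈ bag u) s≡t₀ r∈s)))
    ...     | t′ , t₀~t′ , _ , branch =
      chase (n T′) (edge-trail T′ t₀~t′) (m≤m+n _ _) (connected G _ _) (s , r∈s , branch)

module Cycle4 where

  open import Data.Bool using (Bool; true; false; not; _∨_)
  open import Data.Bool.Properties using () renaming (_≟_ to _≟ᵇ_)
  open import Data.Fin.Subset using (Subset; _∈_)
  open import Data.Fin.Subset.Properties using (_∈?_)
  open import Data.Vec using ([]; _∷_)
  open import Relation.Nullary.Decidable using (from-yes; ⌊_⌋)

  antipode : Fin 4 → Fin 4
  antipode zero                = suc (suc zero)
  antipode (suc zero)          = suc (suc (suc zero))
  antipode (suc (suc zero))    = zero
  antipode (suc (suc (suc _))) = suc zero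

  adjacent : Fin 4 → Fin 4 → Bool
  adjacent u v = not (⌊ u ≟ v ⌋ ∨ ⌊ antipode u ≟ v ⌋)

  adjacent-sym : ∀ u v → adjacent u v ≡ adjacent v u
  adjacent-sym = from-yes (all? λ u → all? λ v → adjacent u v ≟ᵇ adjacent v u)

  to-zero : ∀ u → Star (λ a b → T (adjacent a b)) u zero
  to-zero zero                = ε
  to-zero (suc zero)          = _ ◅ ε
  to-zero (suc (suc zero))    = _◅_ {j = suc zero} _ (_ ◅ ε)
  to-zero (suc (suc (suc _))) = _ ◅ ε

  C₄ : Graph
  C₄ = record
    { n         = 4
    ; E         = adjacent
    ; sym       = adjacent-sym
    ; irrefl    = from-yes (all? λ v → adjacent v v ≟ᵇ false)
    ; nonempty  = s≤s z≤n
    ; connected = λ u v → to-zero u ◅◅ reverse (λ {a} {b} → subst T (adjacent-sym a b)) (to-zero v)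
    }

  distinct : Fin 2 → Fin 2 → Bool
  distinct u v = not ⌊ u ≟ v ⌋

  K₂ : Graph
  K₂ = record
    { n         = 2
    ; E         = distinct
    ; sym       = from-yes (all? λ u → all? λ v → distinct u v ≟ᵇ distinct v u)
    ; irrefl    = from-yes (all? λ v → distinct v v ≟ᵇ false)
    ; nonempty  = s≤s z≤n
    ; connected = λ { zero zero → ε ; zero (suc zero) → _ ◅ ε ; (suc zero) zero → _ ◅ ε ; (suc zero) (suc zero) → ε }
    }

  K₂-tree : Tree
  K₂-tree = record { graph = K₂ ; acyclic = λ cycle → 3≰2 (cycle⇒3≤n K₂ cycle) }
    where
    3≰2 : ¬ 3 ≤ 2
    3≰2 (s≤s (s≤s ()))

  -- The bags {0, 1, 2} and {0, 2, 3}, centred at 1 and 3.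
  bags : Fin 2 → Subset 4
  bags zero       = true ∷ true ∷ true ∷ false ∷ []
  bags (suc zero) = true ∷ false ∷ true ∷ true ∷ []

  centres : Fin 2 → Fin 4
  centres zero       = suc zero
  centres (suc zero) = suc (suc (suc zero))

  decomposition : TreeDecomposition C₄
  decomposition = record
    { tree    = K₂-tree
    ; bag     = bags
    ; covV    = from-yes (all? λ v → any? λ t → v ∈? bags t)
    ; covE    = from-yes (all? λ u → all? λ v → T? (adjacent u v) →-dec any? λ t → (u ∈? bags t) ×-dec (v ∈? bags t))
    ; subtree = λ { v zero zero _ _ → ε ; v (suc zero) (suc zero) _ _ → ε
                  ; v zero (suc zero) v∈t v∈t′ → (_ , v∈t , v∈t′) ◅ ε ; v (suc zero) zero v∈t v∈t′ → (_ , v∈t , v∈t′) ◅ ε }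
    }

  tb-C₄ : TreeBreadthLe C₄ 1
  tb-C₄ = decomposition , λ t → centres t , λ w w∈t → near⇒distLe1 C₄ (centred t w w∈t)
    where
    centred : ∀ t w → w ∈ bags t → Near C₄ (centres t) w
    centred = from-yes (all? λ t → all? λ w → (w ∈? bags t) →-dec near? C₄ (centres t) w)

  copNumber-C₄ : IsCopNumber C₄ 2
  copNumber-C₄ = two-cops , λ { zero _ → zero-cops-lose C₄ ; (suc zero) _ → one-cop-loses ; (suc (suc _)) (s≤s (s≤s ())) }
    where
    two-cops : CopsWin C₄ 2
    two-cops = dominating-pair-wins C₄ zero (suc (suc zero))
                 (from-yes (all? λ r → near? C₄ zero r ⊎-dec near? C₄ (suc (suc zero)) r))

    antipode-near : ∀ {u v} → Near C₄ u v → Near C₄ (antipode u) (antipode v)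
    antipode-near {u} {v} = from-yes (all? λ u → all? λ v → near? C₄ u v →-dec near? C₄ (antipode u) (antipode v)) u v

    one-cop-loses : ¬ CopsWin C₄ 1
    one-cop-loses = one-cop-evaded C₄ antipode antipode-near (from-yes (all? λ v → ¬? (near? C₄ v (antipode v))))

corollary5 : ((G : Graph) → TreeBreadthLe G 1 → ∃[ c ] (IsCopNumber G c × c ≤ 2))
    × ∃[ G ] (TreeBreadthLe G 1 × IsCopNumber G 2)
corollary5 = (λ G (D , narrow) → copNumber≤2 G (two-cops-win G D narrow))
           , Cycle4.C₄ , Cycle4.tb-C₄ , Cycle4.copNumber-C₄
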